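{- Let $w\in \mathbf{C}^{\infty}$ have height $k>0$. If $w$ is single-rooted, then $w$ contains exactly one factor that is a single-rooted minimal word of height $k$. If $w$ is double-rooted, then $w$ contains exactly two factors $u\neq u'$ that are single-rooted minimal words of height $k$.
   Context: Let $\Sigma=\{1,2\}$. A factor of a word $w$ is a word $v$ with $w=xvy$ for some words $x,y$. For a word $w$ over $\Sigma$ written uniquely as $w=x_1^{i_1}\cdots x_n^{i_n}$ with $x_j\in\Sigma$, $x_j\neq x_{j+1}$, $i_j>0$, its run-length encoding is $\Delta(w)=i_1i_2\cdots i_n$. A word $w$ is differentiable if $\Delta(w)$ is a word over $\Sigma$ (equivalently, $w$ contains neither $111$ nor $222$). The derivative $D(w)$ of a differentiable word is defined by $D(\epsilon)=\epsilon$, and otherwise $D(w)$ is obtained from $\Delta(w)$ by deleting its first symbol if that symbol is $1$ and deleting its last symbol if that symbol is $1$ (so $D(w)=\epsilon$ when $\Delta(w)=1$ or $\Delta(w)=11$). $\mathbf{C}^{\infty}$ is the set of words $w$ over $\Sigma$ for which $D^j(w)$ is defined for every $j\ge 0$ ($D^0(w)=w$). The height of $w\in\mathbf{C}^{\infty}$ is the least $k$ with $D^k(w)=\epsilon$. For $w$ of height $k>0$, its root is $D^{k-1}(w)\in\{1,2,12,21\}$; $w$ is single-rooted if its root has length one and double-rooted if its root has length two. A primitive of a word $w$ is any word $w'$ with $D(w')=w$. A word $w\in\mathbf{C}^{\infty}$ of height $k>1$ is minimal if for every $0\le j\le k-2$, $D^j(w)$ is a primitive of $D^{j+1}(w)$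 of minimal length among all primitives of $D^{j+1}(w)$; all words of height $1$ are considered minimal. -}

module Defs where

open import Data.Nat using (ℕ; zero; suc; pred; _≤_)
open import Data.List using (List; []; _∷_; _++_; length)
open import Data.Maybe using (Maybe; just; nothing; _>>=_)
open import Data.Product using (Σ; ∃; ∃-syntax; _×_; _,_)
open import Relation.Binary.PropositionalEquality using (_≡_; _≢_)
open import Relation.Nullary using (¬_)

data Sym : Set where
  one two : Sym

Word : Set
Word = List Sym

runs : Sym → ℕ → Word → List ℕ
runs x n [] = n ∷ []
runs one n (one ∷ ys) = runs one (suc n) ys
runs two n (two ∷ ys) = runs two (suc n) ys
runs one n (two ∷ ys) = n ∷ runs two 1 ys
runs two n (one ∷ ys) = n ∷ runs one 1 ys

Δ : Word → List ℕ
Δ [] = []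
Δ (x ∷ xs) = runs x 1 xs

toSym : ℕ → Maybe Sym
toSym 1 = just one
toSym 2 = just two
toSym _ = nothing

toWord : List ℕ → Maybe Word
toWord [] = just []
toWord (n ∷ ns) = toSym n >>= λ a → toWord ns >>= λ as → just (a ∷ as)

dropHead1 : Word → Word
dropHead1 (one ∷ xs) = xs
dropHead1 xs = xs

dropLast1 : Word → Word
dropLast1 [] = []
dropLast1 (one ∷ []) = []
dropLast1 (two ∷ []) = two ∷ []
dropLast1 (x ∷ y ∷ ys) = x ∷ dropLast1 (y ∷ ys)

-- the derivative D; nothing = not differentiable
D : Word → Maybe Word
D w = toWord (Δ w) >>= λ u → just (dropLast1 (dropHead1 u))

Dⁱ : ℕ → Word → Maybe Word
Dⁱ zero w = just w
Dⁱ (suc j) w = Dⁱ j w >>= D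

C∞ : Word → Set
C∞ w = ∀ j → ∃[ v ] (Dⁱ j w ≡ just v)

Height : Word → ℕ → Set
Height w k = (Dⁱ k w ≡ just []) × (∀ j → suc j ≤ k → Dⁱ j w ≢ just [])

-- root D^{k-1}(w) has length one / two
SingleRooted : Word → Set
SingleRooted w = ∃[ k ] (Height w k × ∃[ a ] (Dⁱ (pred k) w ≡ just (a ∷ [])))

DoubleRooted : Word → Set
DoubleRooted w = ∃[ k ] (Height w k × ∃[ a ] ∃[ b ] (Dⁱ (pred k) w ≡ just (a ∷ b ∷ [])))

Primitive : Word → Word → Set
Primitive w' v = D w' ≡ just v

Minimal : Word → Set
Minimal w = C∞ w × ∃[ k ] (Height w k × (1 ≤ k) ×
  (∀ j → suc (suc j) ≤ k → ∀ u v → Dⁱ j w ≡ just u → Dⁱ (suc j) w ≡ just v →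
     ∀ w' → Primitive w' v → length u ≤ length w'))

Factor : Word → Word → Set
Factor v w = ∃[ x ] ∃[ y ] (w ≡ x ++ v ++ y)

GoodFactor : Word → ℕ → Word → Set
GoodFactor w k v = Factor v w × SingleRooted v × Minimal v × Height v k

module Submission where

-- A differentiable word is expand c t: the word starting with letter c whose run
-- lengths are the letters of t; its derivative is trim t (t without a leading and a
-- trailing 1). The shortest primitives of a nonempty v are the two words
-- expand c (pad v), where pad v adds a 1 at each end of v that is a 1; hence the good
-- words of height k+2 are exactly the expand c (pad v) with v good of height k+1.
-- The core of the proof shows that occurrences of such a word inside expand c t
-- correspond, via "placements" of v in t with room for its padding, one-to-one to
-- occurrences of v in trim t, and that an occurrence upstairs is determined by its
-- image (its position and length are fixed by it). Counting occurrences is thus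
-- invariant under differentiation, and the statement follows by induction on the
-- height from height 1, where the good words are the single letters of the root.

open import Defs
open import Data.Nat using (ℕ; zero; suc; pred; _≤_; _<_; _+_; z≤n; s≤s)
open import Data.Nat.Properties
  using (≤-refl; <⇒≤; <⇒≱; <-cmp; m<n⇒m<1+n; +-monoʳ-<; +-assoc; +-cancelʳ-≡; suc-injective)
open import Data.List using (List; []; _∷_; _++_; length; map; replicate; head; last)
open import Data.List.Properties using (∷-injective; ∷-injectiveˡ; ∷-injectiveʳ; length-++; ++-assoc; ++-identityʳ)
open import Data.Maybe using (Maybe; just; _>>=_)
open import Data.Maybe.Properties using (just-injective)
open import Data.Product using (∃-syntax; _×_; _,_; proj₁; proj₂)
open import Data.Sum using (_⊎_; inj₁; inj₂)
open import Data.Empty using (⊥; ⊥-elim)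
open import Relation.Binary.PropositionalEquality
open import Relation.Binary.Definitions using (tri<; tri≈; tri>)

flip : Sym → Sym
flip one = two
flip two = one

value : Sym → ℕ
value one = 1
value two = 2

weight : Word → ℕ
weight [] = 0
weight (e ∷ t) = value e + weight t

run : Sym → Sym → Word
run c one = c ∷ []
run c two = c ∷ c ∷ []

expand : Sym → Word → Word
expand c [] = []
expand c (e ∷ t) = run c e ++ expand (flip c) t

length-expand : ∀ c t → length (expand c t) ≡ weight t
length-expand c [] = refl
length-expand c (one ∷ t) = cong suc (length-expand (flip c) t)
length-expand c (two ∷ t) = cong (λ n → suc (suc n)) (length-expand (flip c) t)

trim : Word → Word
trim t = dropLast1 (dropHead1 t)

runs-expand : ∀ c n t → runs c n (expand (flip c) t) ≡ n ∷ map value t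
runs-expand c n [] = refl
runs-expand one n (one ∷ t) = cong (n ∷_) (runs-expand two 1 t)
runs-expand two n (one ∷ t) = cong (n ∷_) (runs-expand one 1 t)
runs-expand one n (two ∷ t) = cong (n ∷_) (runs-expand two 2 t)
runs-expand two n (two ∷ t) = cong (n ∷_) (runs-expand one 2 t)

Δ-expand : ∀ c t → Δ (expand c t) ≡ map value t
Δ-expand c [] = refl
Δ-expand c (one ∷ t) = runs-expand c 1 t
Δ-expand one (two ∷ t) = runs-expand one 2 t
Δ-expand two (two ∷ t) = runs-expand two 2 t

toWord-value : ∀ t → toWord (map value t) ≡ just t
toWord-value [] = refl
toWord-value (one ∷ t) rewrite toWord-value t = refl
toWord-value (two ∷ t) rewrite toWord-value t = refl

D-expand : ∀ c t → D (expand c t) ≡ just (trim t)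
D-expand c t rewrite Δ-expand c t | toWord-value t = refl

bind-just : ∀ {A B : Set} (m : Maybe A) (f : A → Maybe B) {b} → (m >>= f) ≡ just b →
  ∃[ a ] (m ≡ just a × f a ≡ just b)
bind-just (just a) f eq = a , refl , eq

toSym-value : ∀ n s → toSym n ≡ just s → n ≡ value s
toSym-value 1 one refl = refl
toSym-value 2 two refl = refl
toSym-value zero s ()
toSym-value (suc (suc (suc n))) s ()

toWord-∷ : ∀ n ns t → toWord (n ∷ ns) ≡ just t →
  ∃[ s ] ∃[ t′ ] (t ≡ s ∷ t′ × n ≡ value s × toWord ns ≡ just t′)
toWord-∷ n ns t eq with bind-just (toSym n) _ eq
... | s , es , eq′ with bind-just (toWord ns) _ eq′
... | t′ , et , refl = s , t′ , refl , toSym-value n s es , et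

replicate-snoc : ∀ (c : Sym) n ys → replicate n c ++ c ∷ ys ≡ c ∷ (replicate n c ++ ys)
replicate-snoc c zero ys = refl
replicate-snoc c (suc n) ys = cong (c ∷_) (replicate-snoc c n ys)

runs-expanded : ∀ c n ys t → toWord (runs c n ys) ≡ just t → replicate n c ++ ys ≡ expand c t
runs-expanded c n [] t eq with toWord-∷ n [] t eq
... | one , [] , refl , refl , _ = refl
... | two , [] , refl , refl , _ = refl
runs-expanded one n (one ∷ ys) t eq = trans (replicate-snoc one n ys) (runs-expanded one (suc n) ys t eq)
runs-expanded two n (two ∷ ys) t eq = trans (replicate-snoc two n ys) (runs-expanded two (suc n) ys t eq)
runs-expanded one n (two ∷ ys) t eq with toWord-∷ n (runs two 1 ys) t eq
... | one , t′ , refl , refl , eq′ = cong (run one one ++_) (runs-expanded two 1 ys t′ eq′)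
... | two , t′ , refl , refl , eq′ = cong (run one two ++_) (runs-expanded two 1 ys t′ eq′)
runs-expanded two n (one ∷ ys) t eq with toWord-∷ n (runs one 1 ys) t eq
... | one , t′ , refl , refl , eq′ = cong (run two one ++_) (runs-expanded one 1 ys t′ eq′)
... | two , t′ , refl , refl , eq′ = cong (run two two ++_) (runs-expanded one 1 ys t′ eq′)

D-expanded : ∀ c w z → D (c ∷ w) ≡ just z → ∃[ t ] (trim t ≡ z × c ∷ w ≡ expand c t)
D-expanded c w z eq with bind-just (toWord (Δ (c ∷ w))) _ eq
... | t , et , refl = t , refl , runs-expanded c 1 w t et

dropLast1-∷ : ∀ x y ys → dropLast1 (x ∷ y ∷ ys) ≡ x ∷ dropLast1 (y ∷ ys)
dropLast1-∷ one y ys = refl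
dropLast1-∷ two y ys = refl

padRight : Word → Word
padRight (x ∷ y ∷ ys) = x ∷ padRight (y ∷ ys)
padRight (one ∷ []) = one ∷ one ∷ []
padRight (two ∷ []) = two ∷ []
padRight [] = []

-- pad v: v with one more 1 added at each end of v that is a 1;
-- it is the lightest word t with trim t = v.
pad : Word → Word
pad (one ∷ v) = one ∷ padRight (one ∷ v)
pad v = padRight v

dropLast1-padRight : ∀ v → dropLast1 (padRight v) ≡ v
dropLast1-padRight [] = refl
dropLast1-padRight (one ∷ []) = refl
dropLast1-padRight (two ∷ []) = refl
dropLast1-padRight (x ∷ one ∷ []) = dropLast1-∷ x one (one ∷ [])
dropLast1-padRight (x ∷ two ∷ []) = dropLast1-∷ x two []
dropLast1-padRight (x ∷ y ∷ z ∷ zs) =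
  trans (dropLast1-∷ x y _) (cong (x ∷_) (dropLast1-padRight (y ∷ z ∷ zs)))

trim-pad : ∀ v → trim (pad v) ≡ v
trim-pad [] = refl
trim-pad (one ∷ vs) = dropLast1-padRight (one ∷ vs)
trim-pad (two ∷ []) = refl
trim-pad (two ∷ y ∷ ys) = dropLast1-padRight (two ∷ y ∷ ys)

PadRightLightest : Word → Word → Set
PadRightLightest s v = s ≡ padRight v ⊎ weight (padRight v) < weight s

padRight-lightest : ∀ s v → dropLast1 s ≡ v → PadRightLightest s v
padRight-lightest [] _ refl = inj₁ refl
padRight-lightest (one ∷ []) _ refl = inj₂ ≤-refl
padRight-lightest (two ∷ []) _ refl = inj₁ refl
padRight-lightest (one ∷ one ∷ []) _ refl = inj₁ refl
padRight-lightest (two ∷ one ∷ []) _ refl = inj₂ ≤-refl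
padRight-lightest (one ∷ two ∷ []) _ refl = inj₁ refl
padRight-lightest (two ∷ two ∷ []) _ refl = inj₁ refl
padRight-lightest (x ∷ y ∷ z ∷ zs) v e =
  subst (PadRightLightest (x ∷ y ∷ z ∷ zs)) v≡
    (extend (padRight-lightest (y ∷ z ∷ zs) (y ∷ dropLast1 (z ∷ zs)) (dropLast1-∷ y z zs)))
  where
  v≡ : x ∷ y ∷ dropLast1 (z ∷ zs) ≡ v
  v≡ = trans (cong (x ∷_) (sym (dropLast1-∷ y z zs))) (trans (sym (dropLast1-∷ x y (z ∷ zs))) e)
  extend : ∀ {r} → PadRightLightest (y ∷ z ∷ zs) (y ∷ r) →
    PadRightLightest (x ∷ y ∷ z ∷ zs) (x ∷ y ∷ r)
  extend (inj₁ eq) = inj₁ (cong (x ∷_) eq)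
  extend (inj₂ lt) = inj₂ (+-monoʳ-< (value x) lt)

dropLast1-two∷ : ∀ s h vs → dropLast1 (two ∷ s) ≡ h ∷ vs → h ≡ two
dropLast1-two∷ [] h vs refl = refl
dropLast1-two∷ (y ∷ ys) h vs refl = refl

pad-lightest : ∀ t h vs → trim t ≡ h ∷ vs → t ≡ pad (h ∷ vs) ⊎ weight (pad (h ∷ vs)) < weight t
pad-lightest [] h vs ()
pad-lightest (one ∷ s) one vs e with padRight-lightest s _ e
... | inj₁ eq = inj₁ (cong (one ∷_) eq)
... | inj₂ lt = inj₂ (s≤s lt)
pad-lightest (one ∷ s) two vs e with padRight-lightest s _ e
... | inj₁ refl = inj₂ ≤-refl
... | inj₂ lt = inj₂ (m<n⇒m<1+n lt)
pad-lightest (two ∷ s) h vs e with dropLast1-two∷ s h vs e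
... | refl = padRight-lightest (two ∷ s) _ e

expand-pad-primitive : ∀ c v → Primitive (expand c (pad v)) v
expand-pad-primitive c v = trans (D-expand c (pad v)) (cong just (trim-pad v))

expand-pad-shortest : ∀ c h vs w′ → Primitive w′ (h ∷ vs) → length (expand c (pad (h ∷ vs))) ≤ length w′
expand-pad-shortest c h vs [] ()
expand-pad-shortest c h vs (c′ ∷ w′) p with D-expanded c′ w′ (h ∷ vs) p
... | t , tt , eq =
  subst₂ _≤_ (sym (length-expand c (pad (h ∷ vs)))) (sym (trans (cong length eq) (length-expand c′ t))) pad≤t
  where
  pad≤t : weight (pad (h ∷ vs)) ≤ weight t
  pad≤t with pad-lightest t h vs tt
  ... | inj₁ refl = ≤-refl
  ... | inj₂ lt = <⇒≤ lt

shortest-primitive : ∀ u h vs → Primitive u (h ∷ vs) →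
  (∀ w′ → Primitive w′ (h ∷ vs) → length u ≤ length w′) → ∃[ c ] (u ≡ expand c (pad (h ∷ vs)))
shortest-primitive [] h vs () _
shortest-primitive (c ∷ u) h vs p shortest with D-expanded c u (h ∷ vs) p
... | t , tt , eq with pad-lightest t h vs tt
... | inj₁ refl = c , eq
... | inj₂ lt = ⊥-elim (<⇒≱ lt (subst₂ _≤_ (trans (cong length eq) (length-expand c t))
                  (length-expand c (pad (h ∷ vs)))
                  (shortest (expand c (pad (h ∷ vs))) (expand-pad-primitive c (h ∷ vs)))))

Dⁱ-suc : ∀ {w z} → D w ≡ just z → ∀ j → Dⁱ (suc j) w ≡ Dⁱ j z
Dⁱ-suc dw zero = dw
Dⁱ-suc dw (suc j) = cong (_>>= D) (Dⁱ-suc dw j)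

height-unique : ∀ {w k k′} → Height w k → Height w k′ → k ≡ k′
height-unique {k = k} {k′} (zero-at-k , positive-below-k) (zero-at-k′ , positive-below-k′) with <-cmp k k′
... | tri< k<k′ _ _ = ⊥-elim (positive-below-k′ k k<k′ zero-at-k)
... | tri≈ _ k≡k′ _ = k≡k′
... | tri> _ _ k′<k = ⊥-elim (positive-below-k k′ k′<k zero-at-k′)

height-down : ∀ {w z k} → D w ≡ just z → Height w (suc k) → Height z k
height-down {k = k} dw (zero-at , positive-below) =
  trans (sym (Dⁱ-suc dw k)) zero-at , λ j j<k e → positive-below (suc j) (s≤s j<k) (trans (Dⁱ-suc dw j) e)

height-up : ∀ {w z k} → D w ≡ just z → w ≢ [] → Height z k → Height w (suc k)
height-up {w} {k = k} dw w≢[] (zero-at , positive-below) = trans (Dⁱ-suc dw k) zero-at , positive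
  where
  positive : ∀ j → suc j ≤ suc k → Dⁱ j w ≢ just []
  positive zero _ e = w≢[] (just-injective e)
  positive (suc j) (s≤s j<k) e = positive-below j j<k (trans (sym (Dⁱ-suc dw j)) e)

C∞-down : ∀ {w z} → D w ≡ just z → C∞ w → C∞ z
C∞-down dw c∞ j with c∞ (suc j)
... | v , e = v , trans (sym (Dⁱ-suc dw j)) e

C∞-up : ∀ {w z} → D w ≡ just z → C∞ z → C∞ w
C∞-up {w} dw c∞ zero = w , refl
C∞-up dw c∞ (suc j) with c∞ j
... | v , e = v , trans (Dⁱ-suc dw j) e

MinimalFrom : Word → ℕ → Set
MinimalFrom w k = ∀ j → suc (suc j) ≤ k → ∀ u v → Dⁱ j w ≡ just u → Dⁱ (suc j) w ≡ just v →
  ∀ w′ → Primitive w′ v → length u ≤ length w′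

minimal-down : ∀ {u v k} → D u ≡ just v → MinimalFrom u (suc k) → MinimalFrom v k
minimal-down du minimal j j+2≤k u′ v′ e e′ =
  minimal (suc j) (s≤s j+2≤k) u′ v′ (trans (Dⁱ-suc du j) e) (trans (Dⁱ-suc du (suc j)) e′)

minimal-up : ∀ {u v k} → D u ≡ just v → (∀ w′ → Primitive w′ v → length u ≤ length w′) →
  MinimalFrom v k → MinimalFrom u (suc k)
minimal-up du shortest minimal zero _ u′ v′ refl dv′ with just-injective (trans (sym dv′) du)
... | refl = shortest
minimal-up du shortest minimal (suc j) (s≤s j+2≤k) u′ v′ e e′ =
  minimal j j+2≤k u′ v′ (trans (sym (Dⁱ-suc du j)) e) (trans (sym (Dⁱ-suc du (suc j))) e′)

Good : ℕ → Word → Set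
Good k u = SingleRooted u × Minimal u × Height u k

good-≢[] : ∀ k → Good (suc k) [] → ⊥
good-≢[] k (_ , _ , H) = proj₂ H 0 (s≤s z≤n) refl

good-down : ∀ k u → Good (suc (suc k)) u →
  ∃[ h ] ∃[ vs ] ∃[ c ] (D u ≡ just (h ∷ vs) × Good (suc k) (h ∷ vs) × u ≡ expand c (pad (h ∷ vs)))
good-down k u ((_ , H₁ , a , root) , (c∞ , _ , H₂ , _ , minimal) , H)
  with height-unique H₁ H | height-unique H₂ H | c∞ 1
... | refl | refl | [] , du = ⊥-elim (proj₂ H 1 (s≤s (s≤s z≤n)) du)
... | refl | refl | h ∷ vs , du with shortest-primitive u h vs du (minimal 0 (s≤s (s≤s z≤n)) u (h ∷ vs) refl du)
... | c , u≡ = h , vs , c , du , ((suc k , Hv , a , trans (sym (Dⁱ-suc du k)) root) ,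
        (C∞-down du c∞ , suc k , Hv , s≤s z≤n , minimal-down du minimal) , Hv) , u≡
  where
  Hv : Height (h ∷ vs) (suc k)
  Hv = height-down du H

good-up : ∀ k v c → Good (suc k) v → Good (suc (suc k)) (expand c (pad v))
good-up k [] c good = ⊥-elim (good-≢[] k good)
good-up k (h ∷ vs) c ((_ , H₁ , a , root) , (c∞ , _ , H₂ , _ , minimal) , H)
  with height-unique H₁ H | height-unique H₂ H
... | refl | refl = (suc (suc k) , Hu , a , trans (Dⁱ-suc du k) root) ,
        (C∞-up du c∞ , suc (suc k) , Hu , s≤s z≤n , minimal-up du (expand-pad-shortest c h vs) minimal) , Hu
  where
  du : D (expand c (pad (h ∷ vs))) ≡ just (h ∷ vs)
  du = expand-pad-primitive c (h ∷ vs)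
  Hu : Height (expand c (pad (h ∷ vs))) (suc (suc k))
  Hu = height-up du (λ e → derivative-nonempty (trans (sym du) (cong D e))) H
    where
    derivative-nonempty : just (h ∷ vs) ≢ just []
    derivative-nonempty ()

flip-≢ : ∀ c → flip c ≢ c
flip-≢ one ()
flip-≢ two ()

expand-head : ∀ c s x r → expand c s ≡ x ∷ r → x ≡ c
expand-head c (one ∷ s) x r refl = refl
expand-head c (two ∷ s) x r refl = refl

expand-starts : ∀ c m y → m ≢ [] → ∃[ r ] (expand c m ++ y ≡ c ∷ r)
expand-starts c [] y m≢[] = ⊥-elim (m≢[] refl)
expand-starts c (one ∷ m) y _ = _ , refl
expand-starts c (two ∷ m) y _ = _ , refl

padRight-≢[] : ∀ h vs → padRight (h ∷ vs) ≢ []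
padRight-≢[] one [] ()
padRight-≢[] two [] ()
padRight-≢[] h (_ ∷ _) ()

whole-run : ∀ c h z r s → run c h ++ z ≡ expand c s → z ≡ flip c ∷ r →
  ∃[ s′ ] (s ≡ h ∷ s′ × z ≡ expand (flip c) s′)
whole-run c one z r (one ∷ s′) eq _ = s′ , refl , ∷-injectiveʳ eq
whole-run c two z r (two ∷ s′) eq _ = s′ , refl , ∷-injectiveʳ (∷-injectiveʳ eq)
whole-run c one z r (two ∷ s′) eq refl = ⊥-elim (flip-≢ c (∷-injectiveˡ (∷-injectiveʳ eq)))
whole-run c two z r (one ∷ s′) eq refl =
  ⊥-elim (flip-≢ c (sym (expand-head (flip c) s′ c _ (sym (∷-injectiveʳ eq)))))
whole-run c one z r [] () _
whole-run c two z r [] () _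

-- Room in t = a ++ v ++ b for the padding of v: a letter before v if v starts
-- with 1, and a letter after v if v ends with 1.
RoomBefore : Word → Word → Set
RoomBefore v a = head v ≡ just one → a ≢ []

RoomAfter : Word → Word → Set
RoomAfter v b = last v ≡ just one → b ≢ []

padRight-prefix : ∀ c v b → RoomAfter v b → ∃[ y ] (expand c (v ++ b) ≡ expand c (padRight v) ++ y)
padRight-prefix c [] b _ = expand c b , refl
padRight-prefix c (one ∷ []) [] room = ⊥-elim (room refl refl)
padRight-prefix c (one ∷ []) (e ∷ b) _ with expand-starts (flip c) (e ∷ b) [] (λ ())
... | r , eq = r , cong (c ∷_) (trans (sym (++-identityʳ _)) eq)
padRight-prefix c (two ∷ []) b _ = expand (flip c) b , refl
padRight-prefix c (h ∷ h′ ∷ vs) b room with padRight-prefix (flip c) (h′ ∷ vs) b room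
... | y , eq = y , (begin
    run c h ++ expand (flip c) ((h′ ∷ vs) ++ b)            ≡⟨ cong (run c h ++_) eq ⟩
    run c h ++ (expand (flip c) (padRight (h′ ∷ vs)) ++ y) ≡⟨ sym (++-assoc (run c h) _ y) ⟩
    (run c h ++ expand (flip c) (padRight (h′ ∷ vs))) ++ y ∎)
  where open ≡-Reasoning

padRight-prefix⁻¹ : ∀ c v y s → expand c (padRight v) ++ y ≡ expand c s → ∃[ b ] (s ≡ v ++ b × RoomAfter v b)
padRight-prefix⁻¹ c [] y s _ = s , refl , λ ()
padRight-prefix⁻¹ c (one ∷ []) y s eq with whole-run c one (flip c ∷ y) y s eq refl
... | s′ , refl , eq′ = s′ , refl , λ _ s′≡[] → flip-nonempty (trans eq′ (cong (expand (flip c)) s′≡[]))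
  where
  flip-nonempty : flip c ∷ y ≢ []
  flip-nonempty ()
padRight-prefix⁻¹ c (two ∷ []) y (two ∷ s′) eq = s′ , refl , λ ()
padRight-prefix⁻¹ c (two ∷ []) y (one ∷ s′) eq =
  ⊥-elim (flip-≢ c (sym (expand-head (flip c) s′ c y (sym (∷-injectiveʳ eq)))))
padRight-prefix⁻¹ c (two ∷ []) y [] ()
padRight-prefix⁻¹ c (h ∷ h′ ∷ vs) y s eq
  with expand-starts (flip c) (padRight (h′ ∷ vs)) y (padRight-≢[] h′ vs)
... | r , starts with whole-run c h _ r s (trans (sym (++-assoc (run c h) _ y)) eq) starts
... | s′ , refl , eq′ with padRight-prefix⁻¹ (flip c) (h′ ∷ vs) y s′ eq′
... | b , refl , room = b , refl , room

-- The leading 1 of a word, if any: exactly the letter that dropHead1 removes,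
-- and the letter that pad adds in front.
leadingOne : Word → Word
leadingOne (one ∷ _) = one ∷ []
leadingOne _ = []

pad-≢[] : ∀ h vs → pad (h ∷ vs) ≢ []
pad-≢[] one vs ()
pad-≢[] two vs = padRight-≢[] two vs

pad-prefix⁻¹ : ∀ c c′ h vs y t → expand c′ (pad (h ∷ vs)) ++ y ≡ expand c t →
  ∃[ b ] (t ≡ leadingOne (h ∷ vs) ++ (h ∷ vs) ++ b × RoomAfter (h ∷ vs) b)
pad-prefix⁻¹ c c′ h vs y t eq with expand-starts c′ (pad (h ∷ vs)) y (pad-≢[] h vs)
... | r , starts with expand-head c t c′ r (trans (sym eq) starts)
pad-prefix⁻¹ c c one vs y t eq | _ | refl
  with expand-starts (flip c) (padRight (one ∷ vs)) y (padRight-≢[] one vs)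
... | r , starts with whole-run c one _ r t eq starts
... | t′ , refl , eq′ with padRight-prefix⁻¹ (flip c) (one ∷ vs) y t′ eq′
... | b , refl , room = b , refl , room
pad-prefix⁻¹ c c two vs y t eq | _ | refl = padRight-prefix⁻¹ c (two ∷ vs) y t eq

Placement : Word → Word → Word → Word → Set
Placement t a v b = t ≡ a ++ v ++ b × RoomBefore v a × RoomAfter v b

occurrence⇒placement : ∀ c t x c′ h vs y → expand c t ≡ x ++ expand c′ (pad (h ∷ vs)) ++ y →
  ∃[ a ] ∃[ b ] (Placement t a (h ∷ vs) b × length x + weight (leadingOne (h ∷ vs)) ≡ weight a)
occurrence⇒placement c t [] c′ h vs y eq with pad-prefix⁻¹ c c′ h vs y t (sym eq)
occurrence⇒placement c t [] c′ one vs y eq | b , t≡ , room = one ∷ [] , b , (t≡ , (λ _ ()) , room) , refl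
occurrence⇒placement c t [] c′ two vs y eq | b , t≡ , room = [] , b , (t≡ , (λ ()) , room) , refl
occurrence⇒placement c [] (_ ∷ _) c′ h vs y ()
occurrence⇒placement c (one ∷ t) (_ ∷ x) c′ h vs y eq
  with occurrence⇒placement (flip c) t x c′ h vs y (∷-injectiveʳ eq)
... | a , b , (refl , _ , room) , pos = one ∷ a , b , (refl , (λ _ ()) , room) , cong suc pos
occurrence⇒placement c (two ∷ t) (_ ∷ _ ∷ x) c′ h vs y eq
  with occurrence⇒placement (flip c) t x c′ h vs y (∷-injectiveʳ (∷-injectiveʳ eq))
... | a , b , (refl , _ , room) , pos = two ∷ a , b , (refl , (λ _ ()) , room) , cong (λ n → suc (suc n)) pos
occurrence⇒placement c (two ∷ t) (_ ∷ []) c′ h vs y eq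
  with pad-prefix⁻¹ c c′ h vs y (one ∷ t) (sym (∷-injectiveʳ eq))
... | b , t≡ , room with h
...   | one = two ∷ [] , b , (cong (two ∷_) (∷-injectiveʳ t≡) , (λ _ ()) , room) , refl
...   | two = ⊥-elim (one≢two (∷-injectiveˡ t≡))
  where
  one≢two : one ≢ two
  one≢two ()

length-run : ∀ c e → length (run c e) ≡ value e
length-run c one = refl
length-run c two = refl

prepend-run : ∀ c e s x U y → expand (flip c) s ≡ x ++ U ++ y → expand c (e ∷ s) ≡ (run c e ++ x) ++ U ++ y
prepend-run c e s x U y eq = trans (cong (run c e ++_) eq) (sym (++-assoc (run c e) x (U ++ y)))

prepend-run-position : ∀ c e x n m → length x + n ≡ m → length (run c e ++ x) + n ≡ value e + m
prepend-run-position c e x n m pos = begin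
  length (run c e ++ x) + n      ≡⟨ cong (_+ n) (length-++ (run c e)) ⟩
  (length (run c e) + length x) + n ≡⟨ +-assoc (length (run c e)) (length x) n ⟩
  length (run c e) + (length x + n) ≡⟨ cong₂ _+_ (length-run c e) pos ⟩
  value e + m ∎
  where open ≡-Reasoning

placement⇒occurrence : ∀ c t a h vs b → Placement t a (h ∷ vs) b →
  ∃[ x ] ∃[ c′ ] ∃[ y ] (expand c t ≡ x ++ expand c′ (pad (h ∷ vs)) ++ y ×
    length x + weight (leadingOne (h ∷ vs)) ≡ weight a)
placement⇒occurrence c _ [] one vs b (refl , room-before , _) = ⊥-elim (room-before refl refl)
placement⇒occurrence c _ [] two vs b (refl , _ , room-after) with padRight-prefix c (two ∷ vs) b room-after
... | y , eq = [] , c , y , eq , refl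
placement⇒occurrence c _ (e ∷ []) one vs b (refl , _ , room-after)
  with padRight-prefix (flip c) (one ∷ vs) b room-after
... | y , eq with e
...   | one = [] , c , y , cong (c ∷_) eq , refl
...   | two = c ∷ [] , c , y , cong (λ w → c ∷ c ∷ w) eq , refl
placement⇒occurrence c _ (e ∷ e′ ∷ a) one vs b (refl , _ , room-after)
  with placement⇒occurrence (flip c) _ (e′ ∷ a) one vs b (refl , (λ _ ()) , room-after)
... | x , c′ , y , eq , pos =
  run c e ++ x , c′ , y , prepend-run c e (e′ ∷ a ++ one ∷ vs ++ b) x _ y eq , prepend-run-position c e x 1 _ pos
placement⇒occurrence c _ (e ∷ a) two vs b (refl , _ , room-after)
  with placement⇒occurrence (flip c) _ a two vs b (refl , (λ ()) , room-after)
... | x , c′ , y , eq , pos =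
  run c e ++ x , c′ , y , prepend-run c e (a ++ two ∷ vs ++ b) x _ y eq , prepend-run-position c e x 0 _ pos

last-++ : ∀ (p : Word) h vs → last (p ++ h ∷ vs) ≡ last (h ∷ vs)
last-++ [] h vs = refl
last-++ (x ∷ []) h vs = refl
last-++ (x ∷ y ∷ p) h vs = last-++ (y ∷ p) h vs

last-placed : ∀ (x : Word) h vs → last (x ++ (h ∷ vs) ++ []) ≡ last (h ∷ vs)
last-placed x h vs = trans (last-++ x h (vs ++ [])) (cong (λ z → last (h ∷ z)) (++-identityʳ vs))

dropLast1-keep : ∀ w → last w ≢ just one → dropLast1 w ≡ w
dropLast1-keep [] _ = refl
dropLast1-keep (one ∷ []) not-one = ⊥-elim (not-one refl)
dropLast1-keep (two ∷ []) _ = refl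
dropLast1-keep (x ∷ y ∷ ys) not-one = trans (dropLast1-∷ x y ys) (cong (x ∷_) (dropLast1-keep (y ∷ ys) not-one))

dropLast1-++ : ∀ p e b → dropLast1 (p ++ e ∷ b) ≡ p ++ dropLast1 (e ∷ b)
dropLast1-++ [] e b = refl
dropLast1-++ (x ∷ []) e b = dropLast1-∷ x e b
dropLast1-++ (x ∷ y ∷ p) e b = trans (dropLast1-∷ x y (p ++ e ∷ b)) (cong (x ∷_) (dropLast1-++ (y ∷ p) e b))

dropLast1-cases : ∀ s → s ≡ dropLast1 s ++ one ∷ [] ⊎ (s ≡ dropLast1 s × last s ≢ just one)
dropLast1-cases [] = inj₂ (refl , λ ())
dropLast1-cases (one ∷ []) = inj₁ refl
dropLast1-cases (two ∷ []) = inj₂ (refl , λ ())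
dropLast1-cases (x ∷ y ∷ ys) with dropLast1-cases (y ∷ ys)
... | inj₁ e = inj₁ (trans (cong (x ∷_) e) (cong (_++ one ∷ []) (sym (dropLast1-∷ x y ys))))
... | inj₂ (e , not-one) = inj₂ (trans (cong (x ∷_) e) (sym (dropLast1-∷ x y ys)) , not-one)

-- Removing a leading 1 or a trailing 1 from t keeps a placed v, thanks to the room around it.
dropHead1-placed : ∀ a h vs b → RoomBefore (h ∷ vs) a →
  ∃[ x ] (dropHead1 (a ++ (h ∷ vs) ++ b) ≡ x ++ (h ∷ vs) ++ b × a ≡ leadingOne (a ++ (h ∷ vs) ++ b) ++ x)
dropHead1-placed [] one vs b room = ⊥-elim (room refl refl)
dropHead1-placed [] two vs b room = [] , refl , refl
dropHead1-placed (one ∷ a) h vs b room = a , refl , refl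
dropHead1-placed (two ∷ a) h vs b room = two ∷ a , refl , refl

dropLast1-placed : ∀ x h vs b → RoomAfter (h ∷ vs) b →
  ∃[ y ] (dropLast1 (x ++ (h ∷ vs) ++ b) ≡ x ++ (h ∷ vs) ++ y)
dropLast1-placed x h vs [] room = [] , dropLast1-keep _ (λ l → room (trans (sym (last-placed x h vs)) l) refl)
dropLast1-placed x h vs (e ∷ b) room = dropLast1 (e ∷ b) , (begin
  dropLast1 (x ++ (h ∷ vs) ++ e ∷ b)   ≡⟨ cong dropLast1 (sym (++-assoc x (h ∷ vs) (e ∷ b))) ⟩
  dropLast1 ((x ++ (h ∷ vs)) ++ e ∷ b) ≡⟨ dropLast1-++ (x ++ (h ∷ vs)) e b ⟩
  (x ++ (h ∷ vs)) ++ dropLast1 (e ∷ b) ≡⟨ ++-assoc x (h ∷ vs) _ ⟩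
  x ++ (h ∷ vs) ++ dropLast1 (e ∷ b)   ∎)
  where open ≡-Reasoning

placement⇒trim-occurrence : ∀ t a h vs b → Placement t a (h ∷ vs) b →
  ∃[ x ] ∃[ y ] (trim t ≡ x ++ (h ∷ vs) ++ y × a ≡ leadingOne t ++ x)
placement⇒trim-occurrence _ a h vs b (refl , room-before , room-after)
  with dropHead1-placed a h vs b room-before
... | x , dropped , a≡ with dropLast1-placed x h vs b room-after
... | y , dropped′ = x , y , trans (cong dropLast1 dropped) dropped′ , a≡

dropLast1-occurrence : ∀ s x h vs y → dropLast1 s ≡ x ++ (h ∷ vs) ++ y →
  ∃[ b ] (s ≡ x ++ (h ∷ vs) ++ b × RoomAfter (h ∷ vs) b)
dropLast1-occurrence s x h vs y eq with dropLast1-cases s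
... | inj₁ s≡ = y ++ one ∷ [] , trans s≡ (trans (cong (_++ one ∷ []) eq) reassociate) , λ _ → snoc-≢[] y
  where
  reassociate : (x ++ (h ∷ vs) ++ y) ++ one ∷ [] ≡ x ++ (h ∷ vs) ++ y ++ one ∷ []
  reassociate = trans (++-assoc x _ _) (cong (x ++_) (++-assoc (h ∷ vs) y _))
  snoc-≢[] : ∀ z → z ++ one ∷ [] ≢ []
  snoc-≢[] [] ()
  snoc-≢[] (_ ∷ _) ()
... | inj₂ (s≡ , not-one) = y , trans s≡ eq , room
  where
  room : RoomAfter (h ∷ vs) y
  room ends-one refl = not-one (trans (cong last (trans s≡ eq)) (trans (last-placed x h vs) ends-one))

trim-occurrence⇒placement : ∀ t x h vs y → trim t ≡ x ++ (h ∷ vs) ++ y →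
  ∃[ b ] Placement t (leadingOne t ++ x) (h ∷ vs) b
trim-occurrence⇒placement [] [] h vs y ()
trim-occurrence⇒placement [] (_ ∷ _) h vs y ()
trim-occurrence⇒placement (one ∷ s) x h vs y eq with dropLast1-occurrence s x h vs y eq
... | b , s≡ , room-after = b , cong (one ∷_) s≡ , (λ _ ()) , room-after
trim-occurrence⇒placement (two ∷ s) [] h vs y eq with dropLast1-two∷ s h (vs ++ y) eq
... | refl with dropLast1-occurrence (two ∷ s) [] two vs y eq
... | b , s≡ , room-after = b , s≡ , (λ ()) , room-after
trim-occurrence⇒placement (two ∷ s) (x₀ ∷ x) h vs y eq with dropLast1-occurrence (two ∷ s) (x₀ ∷ x) h vs y eq
... | b , s≡ , room-after = b , s≡ , (λ _ ()) , room-after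

ExactlyOne : {A : Set} → (A → Set) → Set
ExactlyOne P = ∃[ a ] (P a × ∀ a′ → P a′ → a′ ≡ a)

ExactlyTwo : {A X : Set} → (A → X) → (A → Set) → Set
ExactlyTwo f P = ∃[ a₁ ] ∃[ a₂ ] (f a₁ ≢ f a₂ × P a₁ × P a₂ × ∀ a → P a → a ≡ a₁ ⊎ a ≡ a₂)

record Correspondence {A B : Set} (P : A → Set) (Q : B → Set) (R : A → B → Set) : Set where
  field
    forth : ∀ a → P a → ∃[ b ] (Q b × R a b)
    back : ∀ b → Q b → ∃[ a ] (P a × R a b)
    injective : ∀ a a′ b → P a → P a′ → R a b → R a′ b → a ≡ a′

module _ {A B : Set} {P : A → Set} {Q : B → Set} {R : A → B → Set} (corr : Correspondence P Q R) where
  open Correspondence corr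

  exactlyOne-transfer : ExactlyOne Q → ExactlyOne P
  exactlyOne-transfer (b , q , unique) with back b q
  ... | a , p , r = a , p , only-a
    where
    only-a : ∀ a′ → P a′ → a′ ≡ a
    only-a a′ p′ with forth a′ p′
    ... | b′ , q′ , r′ with unique b′ q′
    ... | refl = injective a′ a b p′ p r′ r

  exactlyTwo-transfer : {X Y : Set} {f : A → X} {g : B → Y} →
    (∀ a a′ b b′ → R a b → R a′ b′ → f a ≡ f a′ → g b ≡ g b′) → ExactlyTwo g Q → ExactlyTwo f P
  exactlyTwo-transfer respects (b₁ , b₂ , g-differ , q₁ , q₂ , only) with back b₁ q₁ | back b₂ q₂
  ... | a₁ , p₁ , r₁ | a₂ , p₂ , r₂ =
    a₁ , a₂ , (λ e → g-differ (respects a₁ a₂ b₁ b₂ r₁ r₂ e)) , p₁ , p₂ , only-a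
    where
    only-a : ∀ a → P a → a ≡ a₁ ⊎ a ≡ a₂
    only-a a p with forth a p
    ... | b , q , r with only b q
    ... | inj₁ refl = inj₁ (injective a a₁ b₁ p p₁ r r₁)
    ... | inj₂ refl = inj₂ (injective a a₂ b₂ p p₂ r r₂)

GoodOccurrence : ℕ → Word → Word × Word → Set
GoodOccurrence k w (x , u) = (∃[ y ] (w ≡ x ++ u ++ y)) × Good k u

++-split : ∀ (x x′ r r′ : Word) → x ++ r ≡ x′ ++ r′ → length x ≡ length x′ → x ≡ x′ × r ≡ r′
++-split [] [] r r′ eq _ = refl , eq
++-split (a ∷ x) (a′ ∷ x′) r r′ eq lengths with ∷-injective eq
... | refl , eq′ with ++-split x x′ r r′ eq′ (suc-injective lengths)
... | refl , r≡ = refl , r≡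

same-occurrence : ∀ {w x u y x′ u′ y′ : Word} → w ≡ x ++ u ++ y → w ≡ x′ ++ u′ ++ y′ →
  length x ≡ length x′ → length u ≡ length u′ → (x , u) ≡ (x′ , u′)
same-occurrence {x = x} {u} {y} {x′} {u′} {y′} e e′ lx lu with ++-split x x′ _ _ (trans (sym e) e′) lx
... | refl , rest with ++-split u u′ y y′ rest lu
... | refl , _ = refl

-- The relation between an occurrence (x , u) in expand c t and the occurrence
-- (x̃ , v) of its derivative v in trim t: position and length are tied to v.
Derived : Word → Word × Word → Word × Word → Set
Derived t (x , u) (x̃ , v) = D u ≡ just v ×
  length x + weight (leadingOne v) ≡ weight (leadingOne t ++ x̃) × length u ≡ weight (pad v)

derivative-correspondence : ∀ k c t →
  Correspondence (GoodOccurrence (suc (suc k)) (expand c t)) (GoodOccurrence (suc k) (trim t)) (Derived t)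
derivative-correspondence k c t = record { forth = forth ; back = back ; injective = injective }
  where
  forth : ∀ o → GoodOccurrence (suc (suc k)) (expand c t) o →
    ∃[ õ ] (GoodOccurrence (suc k) (trim t) õ × Derived t o õ)
  forth (x , u) ((y , eq) , good-u) with good-down k u good-u
  ... | h , vs , c′ , du , good-v , refl with occurrence⇒placement c t x c′ h vs y eq
  ... | a , b , placed , pos with placement⇒trim-occurrence t a h vs b placed
  ... | x̃ , ỹ , eq′ , a≡ =
    (x̃ , h ∷ vs) , ((ỹ , eq′) , good-v) , du , trans pos (cong weight a≡) , length-expand c′ (pad (h ∷ vs))

  back : ∀ õ → GoodOccurrence (suc k) (trim t) õ →
    ∃[ o ] (GoodOccurrence (suc (suc k)) (expand c t) o × Derived t o õ)
  back (x̃ , []) (_ , good-v) = ⊥-elim (good-≢[] k good-v)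
  back (x̃ , h ∷ vs) ((ỹ , eq) , good-v) with trim-occurrence⇒placement t x̃ h vs ỹ eq
  ... | b , placed with placement⇒occurrence c t (leadingOne t ++ x̃) h vs b placed
  ... | x , c′ , y , eq′ , pos =
    (x , expand c′ (pad (h ∷ vs))) , ((y , eq′) , good-up k (h ∷ vs) c′ good-v) ,
    expand-pad-primitive c′ (h ∷ vs) , pos , length-expand c′ (pad (h ∷ vs))

  injective : ∀ o o′ õ → GoodOccurrence (suc (suc k)) (expand c t) o →
    GoodOccurrence (suc (suc k)) (expand c t) o′ → Derived t o õ → Derived t o′ õ → o ≡ o′
  injective (x , u) (x′ , u′) (x̃ , v) ((y , eq) , _) ((y′ , eq′) , _) (_ , pos , len) (_ , pos′ , len′) =
    same-occurrence eq eq′ (+-cancelʳ-≡ _ (length x) (length x′) (trans pos (sym pos′))) (trans len (sym len′))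

derived-factors : ∀ t o o′ õ õ′ → Derived t o õ → Derived t o′ õ′ →
  proj₂ o ≡ proj₂ o′ → proj₂ õ ≡ proj₂ õ′
derived-factors t o o′ õ õ′ (du , _) (du′ , _) refl = just-injective (trans (sym du) du′)

RootClaim : ℕ → Word → Set
RootClaim k w = (∀ a → Dⁱ (pred k) w ≡ just (a ∷ []) → ExactlyOne (GoodOccurrence k w))
  × (∀ a b → Dⁱ (pred k) w ≡ just (a ∷ b ∷ []) → ExactlyTwo proj₂ (GoodOccurrence k w))

D-letter : ∀ a → D (a ∷ []) ≡ just []
D-letter one = refl
D-letter two = refl

Dⁱ-[] : ∀ j → Dⁱ j [] ≡ just []
Dⁱ-[] zero = refl
Dⁱ-[] (suc j) = cong (_>>= D) (Dⁱ-[] j)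

good-letter : ∀ a → Good 1 (a ∷ [])
good-letter a = (1 , H , a , refl) , (c∞ , 1 , H , s≤s z≤n , λ { _ (s≤s ()) }) , H
  where
  H : Height (a ∷ []) 1
  H = D-letter a , λ { zero _ () ; (suc j) (s≤s ()) }
  c∞ : C∞ (a ∷ [])
  c∞ zero = a ∷ [] , refl
  c∞ (suc j) = [] , trans (Dⁱ-suc (D-letter a) j) (Dⁱ-[] j)

good-height-1 : ∀ u → Good 1 u → ∃[ b ] (u ≡ b ∷ [])
good-height-1 u ((_ , H₁ , b , root) , _ , H) with height-unique H₁ H
... | refl = b , just-injective root

letter-in-letter : ∀ (a : Sym) x b y → a ∷ [] ≡ x ++ b ∷ y → (x , b ∷ []) ≡ ([] , a ∷ [])
letter-in-letter a [] .a [] refl = refl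
letter-in-letter a (_ ∷ []) b y ()
letter-in-letter a (_ ∷ _ ∷ _) b y ()

letter-in-pair : ∀ (a a′ : Sym) x b y → a ∷ a′ ∷ [] ≡ x ++ b ∷ y →
  (x , b ∷ []) ≡ ([] , a ∷ []) ⊎ (x , b ∷ []) ≡ (a ∷ [] , a′ ∷ [])
letter-in-pair a a′ [] .a .(a′ ∷ []) refl = inj₁ refl
letter-in-pair a a′ (.a ∷ []) .a′ .[] refl = inj₂ refl
letter-in-pair a a′ (_ ∷ _ ∷ []) b y ()
letter-in-pair a a′ (_ ∷ _ ∷ _ ∷ _) b y ()

-- A word of height 1 with two letters has distinct letters (aa has derivative 2).
repeated-letter : ∀ a → D (a ∷ a ∷ []) ≢ just []
repeated-letter one ()
repeated-letter two ()

-- Height 1: a word of height 1 is its own root, so its good occurrences are its letters.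
root-claim-1 : ∀ w → Height w 1 → RootClaim 1 w
root-claim-1 w H = single , double
  where
  single : ∀ a → just w ≡ just (a ∷ []) → ExactlyOne (GoodOccurrence 1 w)
  single a refl = ([] , a ∷ []) , (([] , refl) , good-letter a) , only
    where
    only : ∀ o → GoodOccurrence 1 (a ∷ []) o → o ≡ ([] , a ∷ [])
    only (x , u) ((y , eq) , good) with good-height-1 u good
    ... | b , refl = letter-in-letter a x b y eq
  double : ∀ a b → just w ≡ just (a ∷ b ∷ []) → ExactlyTwo proj₂ (GoodOccurrence 1 w)
  double a b refl =
    ([] , a ∷ []) , (a ∷ [] , b ∷ []) , a≢b ,
    ((b ∷ [] , refl) , good-letter a) , (([] , refl) , good-letter b) , only
    where
    a≢b : a ∷ [] ≢ b ∷ []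
    a≢b refl = repeated-letter a (proj₁ H)
    only : ∀ o → GoodOccurrence 1 (a ∷ b ∷ []) o → o ≡ ([] , a ∷ []) ⊎ o ≡ (a ∷ [] , b ∷ [])
    only (x , u) ((y , eq) , good) with good-height-1 u good
    ... | e , refl = letter-in-pair a b x e y eq

-- Height k+2: the root of expand c t is the root of trim t, and good occurrences
-- correspond under differentiation.
root-claim-step : ∀ k c t → RootClaim (suc k) (trim t) → RootClaim (suc (suc k)) (expand c t)
root-claim-step k c t (single , double) = single′ , double′
  where
  corr : Correspondence (GoodOccurrence (suc (suc k)) (expand c t)) (GoodOccurrence (suc k) (trim t)) (Derived t)
  corr = derivative-correspondence k c t
  same-root : Dⁱ (suc k) (expand c t) ≡ Dⁱ k (trim t)
  same-root = Dⁱ-suc (D-expand c t) k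
  single′ : ∀ a → Dⁱ (suc k) (expand c t) ≡ just (a ∷ []) →
    ExactlyOne (GoodOccurrence (suc (suc k)) (expand c t))
  single′ a root = exactlyOne-transfer corr (single a (trans (sym same-root) root))
  double′ : ∀ a b → Dⁱ (suc k) (expand c t) ≡ just (a ∷ b ∷ []) →
    ExactlyTwo proj₂ (GoodOccurrence (suc (suc k)) (expand c t))
  double′ a b root = exactlyTwo-transfer corr (derived-factors t) (double a b (trans (sym same-root) root))

-- The claim for all heights, by induction: a word of height k+2 is an expansion
-- whose trim is its derivative, of height k+1.
root-claim : ∀ k w → C∞ w → Height w (suc k) → RootClaim (suc k) w
root-claim zero w _ H = root-claim-1 w H
root-claim (suc k) [] _ H = ⊥-elim (proj₂ H 0 (s≤s z≤n) refl)
root-claim (suc k) (c ∷ w) c∞ H with c∞ 1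
... | z , dz with D-expanded c w z dz
... | t , refl , w≡ = subst (RootClaim (suc (suc k))) (sym w≡)
  (root-claim-step k c t (root-claim k (trim t) (C∞-down dz c∞) (height-down dz H)))

unique-factor : ∀ k w → ExactlyOne (GoodOccurrence k w) →
  ∃[ u ] (GoodFactor w k u × (∀ v → GoodFactor w k v → v ≡ u))
unique-factor k w ((x , u) , ((y , eq) , good) , only) =
  u , ((x , y , eq) , good) ,
  λ { v ((x′ , y′ , eq′) , good′) → cong proj₂ (only (x′ , v) ((y′ , eq′) , good′)) }

two-factors : ∀ k w → ExactlyTwo proj₂ (GoodOccurrence k w) →
  ∃[ u ] ∃[ u′ ] (u ≢ u′ × GoodFactor w k u × GoodFactor w k u′ ×
    (∀ v → GoodFactor w k v → v ≡ u ⊎ v ≡ u′))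
two-factors k w ((x₁ , u₁) , (x₂ , u₂) , differ , ((y₁ , eq₁) , good₁) , ((y₂ , eq₂) , good₂) , only) =
  u₁ , u₂ , differ , ((x₁ , y₁ , eq₁) , good₁) , ((x₂ , y₂ , eq₂) , good₂) , either
  where
  either : ∀ v → GoodFactor w k v → v ≡ u₁ ⊎ v ≡ u₂
  either v ((x , y , eq) , good) with only (x , v) ((y , eq) , good)
  ... | inj₁ o≡ = inj₁ (cong proj₂ o≡)
  ... | inj₂ o≡ = inj₂ (cong proj₂ o≡)

theorem2 : (w : Word) (k : ℕ) → C∞ w → Height w k → 1 ≤ k →
    (SingleRooted w → ∃[ u ] (GoodFactor w k u × (∀ v → GoodFactor w k v → v ≡ u)))
    × (DoubleRooted w → ∃[ u ] ∃[ u′ ] (u ≢ u′ × GoodFactor w k u × GoodFactor w k u′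
         × (∀ v → GoodFactor w k v → v ≡ u ⊎ v ≡ u′)))
theorem2 w (suc k) c∞ H (s≤s z≤n) = single , double
  where
  claim : RootClaim (suc k) w
  claim = root-claim k w c∞ H
  single : SingleRooted w → ∃[ u ] (GoodFactor w (suc k) u × (∀ v → GoodFactor w (suc k) v → v ≡ u))
  single (_ , H′ , a , root) with height-unique H′ H
  ... | refl = unique-factor (suc k) w (proj₁ claim a root)
  double : DoubleRooted w → ∃[ u ] ∃[ u′ ] (u ≢ u′ × GoodFactor w (suc k) u × GoodFactor w (suc k) u′
         × (∀ v → GoodFactor w (suc k) v → v ≡ u ⊎ v ≡ u′))
  double (_ , H′ , a , b , root) with height-unique H′ H
  ... | refl = two-factors (suc k) w (proj₂ claim a b root)
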